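{- Fix $n\ge1$. For $k\ge 0$ let $s_k$ be the number of $k\times k$ symmetric zero-one matrices with exactly $n$ ones, and let $S_{11}(n)$ be the number of symmetric square zero-one matrices (of any size) with exactly $n$ ones and no zero row or zero column. Define $\psi_k=s_k2^{ -k-1}/S_{11}(n)$, a probability distribution on the nonnegative integers. Consider the random procedure: (i) draw an integer $K$ with distribution $\psi_k$; (ii) choose a $K\times K$ symmetric zero-one matrix with exactly $n$ ones uniformly at random; (iii) delete all rows and all columns all of whose entries are zero. Then the output is uniformly distributed over the symmetric zero-one matrices with exactly $n$ ones and no zero row or column, each being produced with probability $1/S_{11}(n)$.
   Context: Matrices are counted as arrays: the order of rows and columns matters and repeated rows or columns are allowed. The fact that $\psi_k$ sums to $1$ is part of the setting (it follows from $S_{11}(n)=\sum_{k\ge0}s_k2^{ -k-1}$). -}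

module Defs where

open import Data.Bool using (Bool; true; false; _∧_; if_then_else_)
import Data.Bool.Properties as BoolP
open import Data.Nat as ℕ using (ℕ; zero; suc; _≤_)
import Data.Nat.Properties as ℕP
open import Data.Integer using (+_)
open import Data.Rational using (ℚ; 0ℚ; _/_; _+_; _*_; _-_; ∣_∣; _<_)
open import Data.List as List using (List; []; _∷_; concatMap; filter; length; zip; upTo)
open import Data.Bool.ListAction using (or; and)
open import Data.Nat.ListAction using (sum)
import Data.List.Properties as ListP
open import Data.Vec as Vec using (Vec; []; _∷_; toList; transpose)
import Data.Vec.Properties as VecP
open import Data.Product using (_×_; _,_; proj₁; proj₂; ∃)
open import Relation.Nullary using (does)
open import Relation.Nullary.Decidable using (⌊_⌋)

-- A k×k zero-one matrix (Bool: true = 1), as a vector of rows.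
Matrix : ℕ → Set
Matrix k = Vec (Vec Bool k) k

allVecs : {A : Set} → List A → (k : ℕ) → List (Vec A k)
allVecs xs zero = [] ∷ []
allVecs xs (suc k) = concatMap (λ x → List.map (x ∷_) (allVecs xs k)) xs

allMatrices : (k : ℕ) → List (Matrix k)
allMatrices k = allVecs (allVecs (false ∷ true ∷ []) k) k

onesRow : {k : ℕ} → Vec Bool k → ℕ
onesRow r = length (filter (λ b → b BoolP.≟ true) (toList r))

ones : {k : ℕ} → Matrix k → ℕ
ones M = sum (List.map onesRow (toList M))

isSymmetric : {k : ℕ} → Matrix k → Bool
isSymmetric M = does (VecP.≡-dec (VecP.≡-dec BoolP._≟_) M (transpose M))

nonzeroRow : {k : ℕ} → Vec Bool k → Bool
nonzeroRow r = or (toList r)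

noZeroRowCol : {k : ℕ} → Matrix k → Bool
noZeroRowCol M = and (List.map nonzeroRow (toList M)) ∧ and (List.map nonzeroRow (toList (transpose M)))

deleteZeroRowsCols : {k : ℕ} → Matrix k → List (List Bool)
deleteZeroRowsCols M =
  List.map (λ r → List.map proj₂ (filter (λ p → proj₁ p BoolP.≟ true) (zip colMask (toList r))))
           (filter (λ r → nonzeroRow r BoolP.≟ true) (toList M))
  where
  colMask : List Bool
  colMask = List.map nonzeroRow (toList (transpose M))

asLists : {k : ℕ} → Matrix k → List (List Bool)
asLists M = List.map toList (toList M)

eqLL : List (List Bool) → List (List Bool) → Bool
eqLL a b = does (ListP.≡-dec (ListP.≡-dec BoolP._≟_) a b)

countIf : {A : Set} → (A → Bool) → List A → ℕ
countIf p xs = length (filter (λ x → p x BoolP.≟ true) xs)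

symWithOnes : (n : ℕ) {k : ℕ} → Matrix k → Bool
symWithOnes n M = isSymmetric M ∧ ⌊ ones M ℕ.≟ n ⌋

s : (n k : ℕ) → ℕ
s n k = countIf (symWithOnes n) (allMatrices k)

-- Such a matrix has size m ≤ n (each row contains a one),
-- so the sum ranges over sizes m = 0,…,n.
S11 : ℕ → ℕ
S11 n = sum (List.map (λ m → countIf (λ M → symWithOnes n M ∧ noZeroRowCol M) (allMatrices m)) (upTo (suc n)))

-- a / b as a rational, with the convention a / 0 = 0
frac : ℕ → ℕ → ℚ
frac a zero = 0ℚ
frac a (suc b) = (+ a) / suc b

ψ : (n k : ℕ) → ℚ
ψ n k = frac (s n k) (2 ℕ.^ suc k ℕ.* S11 n)

-- probability that step (ii)+(iii), with K = k, outputs the matrix M: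
-- (# k×k symmetric matrices with n ones reducing to M) / s_k
condProb : (n k : ℕ) {m : ℕ} → Matrix m → ℚ
condProb n k M =
  frac (countIf (λ A → symWithOnes n A ∧ eqLL (deleteZeroRowsCols A) (asLists M)) (allMatrices k)) (s n k)

partialSum : (ℕ → ℚ) → ℕ → ℚ
partialSum f zero = 0ℚ
partialSum f (suc N) = partialSum f N + f N

HasSum : (ℕ → ℚ) → ℚ → Set
HasSum f L = ∀ (ε : ℚ) → 0ℚ < ε → ∃ λ N → ∀ K → N ≤ K → ∣ partialSum f K - L ∣ < ε

outputProb : (n : ℕ) {m : ℕ} → Matrix m → ℚ → Set
outputProb n M p = HasSum (λ k → ψ n k * condProb n k M) p

{-# OPTIONS --safe #-}
module Submission where

-- A K×K symmetric matrix with n ones reduces to M exactly when it arises from M by inserting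
-- zero rows, and the matching zero columns, at the K − m positions outside a mask x ∈ {0,1}^K
-- with m ones; the mask is recovered as the set of nonzero rows. Hence C(K,m) of the s_K
-- matrices of size K reduce to M, and the K-th term of the series is
-- ψ_K · C(K,m) / s_K = C(K,m) / (2^(K+1) S₁₁(n)). The negative binomial series
-- ∑_K C(K,m) 2^-(K+1) = 1 gives the total 1/S₁₁(n): after K terms the remainder is
-- ∑_{j≤m} C(K,j) / (2^K S₁₁(n)), a polynomial in K over 2^K, which tends to 0.

open import Defs
open import Data.Bool using (Bool; true; false; _∧_; _∨_; if_then_else_)
import Data.Bool.Properties as BoolP
open import Data.Bool.ListAction using (and)
open import Data.Nat as ℕ using (ℕ; zero; suc; _+_; _*_; _^_; _∸_; _≤_; _<_; z≤n; s≤s)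
import Data.Nat.Properties as ℕP
open import Data.Nat.Combinatorics using (_C_; nCk+nC[k+1]≡[n+1]C[k+1])
open import Data.Nat.ListAction using (sum)
open import Data.Nat.ListAction.Properties using (sum-++)
open import Data.Nat.Tactic.RingSolver using (solve-∀)
open import Data.Integer as ℤ using (-[1+_])
import Data.Integer.Properties as ℤP
open import Data.Rational as ℚ using (ℚ; 0ℚ; mkℚ; toℚᵘ; ∣_∣)
import Data.Rational.Properties as ℚP
open import Data.Rational.Unnormalised as ℚᵘ using (mkℚᵘ; *≡*; *<*)
import Data.Rational.Unnormalised.Properties as ℚᵘP
open import Data.List as List using (List; []; _∷_; _++_; concatMap; filter; length; zip)
import Data.List.Properties as ListP
open import Data.Vec as Vec using (Vec; []; _∷_; toList; fromList; transpose; replicate; zipWith)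
import Data.Vec.Properties as VecP
open import Data.Product using (_×_; ∃; _,_; proj₁; proj₂)
open import Data.Empty using (⊥-elim)
open import Function using (_∘_)
open import Algebra.Properties.CommutativeSemigroup ℕP.+-commutativeSemigroup using (interchange)
open import Algebra.Properties.AbelianGroup ℚP.+-0-abelianGroup using (⁻¹-anti-homo‿-; xyx⁻¹≈y)
open import Relation.Binary.Definitions using (DecidableEquality)
open import Relation.Binary.PropositionalEquality
open import Relation.Nullary using (Dec; yes; no; does; _×-dec_)
open import Relation.Nullary.Decidable using (dec-true; isYes≗does)
open import Relation.Nullary.Reflects using (Reflects; invert)
open import Relation.Unary using (Decidable)

private
  variable
    A B : Set
    k m n : ℕ

-- Finite sums and double counting

∑ : List A → (A → ℕ) → ℕ
∑ xs f = sum (List.map f xs)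

𝟙 : Bool → ℕ
𝟙 b = if b then 1 else 0

∑-cong : (xs : List A) {f g : A → ℕ} → (∀ x → f x ≡ g x) → ∑ xs f ≡ ∑ xs g
∑-cong xs f≗g = cong sum (ListP.map-cong f≗g xs)

∑-zero : (xs : List A) {f : A → ℕ} → (∀ x → f x ≡ 0) → ∑ xs f ≡ 0
∑-zero []       f≗0 = refl
∑-zero (x ∷ xs) f≗0 = cong₂ _+_ (f≗0 x) (∑-zero xs f≗0)

∑-+ : (xs : List A) (f g : A → ℕ) → ∑ xs (λ x → f x + g x) ≡ ∑ xs f + ∑ xs g
∑-+ []       f g = refl
∑-+ (x ∷ xs) f g =
  trans (cong (f x + g x +_) (∑-+ xs f g)) (interchange (f x) (g x) (∑ xs f) (∑ xs g))

∑-swap : (xs : List A) (ys : List B) (f : A → B → ℕ) →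
         ∑ xs (λ x → ∑ ys (f x)) ≡ ∑ ys (λ y → ∑ xs (λ x → f x y))
∑-swap []       ys f = sym (∑-zero ys (λ _ → refl))
∑-swap (x ∷ xs) ys f = trans (cong (∑ ys (f x) +_) (∑-swap xs ys f)) (sym (∑-+ ys (f x) _))

∑-map : (g : A → B) (xs : List A) (f : B → ℕ) → ∑ (List.map g xs) f ≡ ∑ xs (f ∘ g)
∑-map g xs f = cong sum (sym (ListP.map-∘ xs))

∑-++ : (xs ys : List A) (f : A → ℕ) → ∑ (xs ++ ys) f ≡ ∑ xs f + ∑ ys f
∑-++ xs ys f = trans (cong sum (ListP.map-++ f xs ys)) (sum-++ (List.map f xs) (List.map f ys))

∑-concatMap : (g : A → List B) (xs : List A) (f : B → ℕ) →
              ∑ (concatMap g xs) f ≡ ∑ xs (λ x → ∑ (g x) f)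
∑-concatMap g []       f = refl
∑-concatMap g (x ∷ xs) f =
  trans (∑-++ (g x) (concatMap g xs) f) (cong (∑ (g x) f +_) (∑-concatMap g xs f))

∑-allVecs-suc : (xs : List A) (k : ℕ) (f : Vec A (suc k) → ℕ) →
                ∑ (allVecs xs (suc k)) f ≡ ∑ xs (λ a → ∑ (allVecs xs k) (λ v → f (a ∷ v)))
∑-allVecs-suc xs k f = trans (∑-concatMap _ xs f) (∑-cong xs (λ a → ∑-map (a ∷_) (allVecs xs k) f))

countIf-∑ : (p : A → Bool) (xs : List A) → countIf p xs ≡ ∑ xs (𝟙 ∘ p)
countIf-∑ p []       = refl
countIf-∑ p (x ∷ xs) with p x
... | true  = cong suc (countIf-∑ p xs)
... | false = countIf-∑ p xs

countIf-cong : {p q : A → Bool} (xs : List A) → (∀ x → p x ≡ q x) → countIf p xs ≡ countIf q xs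
countIf-cong {p = p} {q} xs p≗q =
  trans (countIf-∑ p xs) (trans (∑-cong xs (cong 𝟙 ∘ p≗q)) (sym (countIf-∑ q xs)))

countIf-∧-≤ : (p q : A → Bool) (xs : List A) → countIf (λ x → p x ∧ q x) xs ≤ countIf p xs
countIf-∧-≤ p q []       = z≤n
countIf-∧-≤ p q (x ∷ xs) with p x | q x
... | true  | true  = s≤s (countIf-∧-≤ p q xs)
... | true  | false = ℕP.m≤n⇒m≤1+n (countIf-∧-≤ p q xs)
... | false | _     = countIf-∧-≤ p q xs

-- xs lists every element of A exactly once, phrased as: summing over xs evaluates point masses.
Enumerates : List A → Set
Enumerates {A} xs = ∀ a (f : A → ℕ) → (∀ b → b ≢ a → f b ≡ 0) → ∑ xs f ≡ f a

bits : List Bool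
bits = false ∷ true ∷ []

enumerates-bits : Enumerates bits
enumerates-bits false f off = trans (cong (λ t → f false + (t + 0)) (off true λ ())) (ℕP.+-identityʳ _)
enumerates-bits true  f off = trans (cong (_+ (f true + 0)) (off false λ ())) (ℕP.+-identityʳ _)

enumerates-allVecs : {xs : List A} → Enumerates xs → ∀ k → Enumerates (allVecs xs k)
enumerates-allVecs enum zero    []      f off = ℕP.+-identityʳ (f [])
enumerates-allVecs {xs = xs} enum (suc k) (a ∷ v) f off = begin
  ∑ (allVecs xs (suc k)) f                          ≡⟨ ∑-allVecs-suc xs k f ⟩
  ∑ xs (λ b → ∑ (allVecs xs k) (λ w → f (b ∷ w)))  ≡⟨ ∑-cong xs column ⟩
  ∑ xs (λ b → f (b ∷ v))                            ≡⟨ enum a _ (λ b b≢a → off _ (b≢a ∘ VecP.∷-injectiveˡ)) ⟩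
  f (a ∷ v)                                         ∎
  where
  open ≡-Reasoning
  column : ∀ b → ∑ (allVecs xs k) (λ w → f (b ∷ w)) ≡ f (b ∷ v)
  column b = enumerates-allVecs enum k v _ (λ w w≢v → off _ (w≢v ∘ VecP.∷-injectiveʳ))

enumerates-allMatrices : ∀ k → Enumerates (allMatrices k)
enumerates-allMatrices k = enumerates-allVecs (enumerates-allVecs enumerates-bits k) k

-- Both sides count the pairs (a, b) with P a and b ≡ f a, summed in either order.
countIf-bijection : {P : A → Set} {Q : B → Set} (P? : Decidable P) (Q? : Decidable Q) →
  DecidableEquality B → {xs : List A} {ys : List B} → Enumerates xs → Enumerates ys →
  (f : A → B) (g : B → A) → (∀ {a} → P a → Q (f a)) → (∀ {b} → Q b → P (g b)) →
  (∀ {a} → P a → g (f a) ≡ a) → (∀ {b} → Q b → f (g b) ≡ b) →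
  countIf (does ∘ P?) xs ≡ countIf (does ∘ Q?) ys
countIf-bijection {A = A} {B = B} {P = P} {Q} P? Q? _≟_ {xs} {ys} enumA enumB f g f⁺ g⁺ gf≡id fg≡id = begin
  countIf (does ∘ P?) xs           ≡⟨ countIf-∑ _ xs ⟩
  ∑ xs (𝟙 ∘ does ∘ P?)             ≡⟨ ∑-cong xs (sym ∘ row) ⟩
  ∑ xs (λ a → ∑ ys (δ a))          ≡⟨ ∑-swap xs ys δ ⟩
  ∑ ys (λ b → ∑ xs (λ a → δ a b))  ≡⟨ ∑-cong ys column ⟩
  ∑ ys (𝟙 ∘ does ∘ Q?)             ≡⟨ countIf-∑ _ ys ⟨
  countIf (does ∘ Q?) ys           ∎
  where
  open ≡-Reasoning
  δ : A → B → ℕ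
  δ a b = 𝟙 (does (P? a) ∧ does (b ≟ f a))

  δ-zero : ∀ a b → (P a → b ≢ f a) → δ a b ≡ 0
  δ-zero a b h with P? a | b ≟ f a
  ... | yes pa | yes b≡fa = ⊥-elim (h pa b≡fa)
  ... | yes _  | no _     = refl
  ... | no _   | _        = refl

  δ-one : ∀ {a b} → P a → b ≡ f a → δ a b ≡ 1
  δ-one {a} {b} pa b≡fa rewrite dec-true (P? a) pa | dec-true (b ≟ f a) b≡fa = refl

  row : ∀ a → ∑ ys (δ a) ≡ 𝟙 (does (P? a))
  row a = trans (enumB (f a) (δ a) (λ b b≢fa → δ-zero a b (λ _ → b≢fa)))
                (cong 𝟙 (trans (cong (does (P? a) ∧_) (dec-true (f a ≟ f a) refl)) (BoolP.∧-identityʳ _)))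

  column : ∀ b → ∑ xs (λ a → δ a b) ≡ 𝟙 (does (Q? b))
  column b with Q? b
  ... | yes qb = trans (enumA (g b) (λ a → δ a b) off) (δ-one (g⁺ qb) (sym (fg≡id qb)))
    where
    off : ∀ a → a ≢ g b → δ a b ≡ 0
    off a a≢gb = δ-zero a b (λ pa b≡fa → a≢gb (trans (sym (gf≡id pa)) (cong g (sym b≡fa))))
  ... | no ¬qb = ∑-zero xs (λ a → δ-zero a b (λ pa b≡fa → ¬qb (subst Q (sym b≡fa) (f⁺ pa))))

∑-masks : ∀ k m → ∑ (allVecs bits k) (λ x → 𝟙 (does (onesRow x ℕ.≟ m))) ≡ k C m
∑-masks zero    zero    = refl
∑-masks zero    (suc m) = refl
∑-masks (suc k) m       = trans (∑-allVecs-suc bits k _) (pascal m)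
  where
  pascal : ∀ m → ∑ (allVecs bits k) (λ x → 𝟙 (does (onesRow x ℕ.≟ m)))
               + (∑ (allVecs bits k) (λ x → 𝟙 (does (suc (onesRow x) ℕ.≟ m))) + 0) ≡ suc k C m
  pascal zero    = cong₂ _+_ (∑-masks k zero) (trans (ℕP.+-identityʳ _) (∑-zero (allVecs bits k) (λ _ → refl)))
  pascal (suc m) = begin
    ∑ (allVecs bits k) (λ x → 𝟙 (does (onesRow x ℕ.≟ suc m)))
      + (∑ (allVecs bits k) (λ x → 𝟙 (does (onesRow x ℕ.≟ m))) + 0)
                       ≡⟨ cong₂ _+_ (∑-masks k (suc m)) (trans (ℕP.+-identityʳ _) (∑-masks k m)) ⟩
    k C suc m + k C m  ≡⟨ ℕP.+-comm (k C suc m) (k C m) ⟩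
    k C m + k C suc m  ≡⟨ nCk+nC[k+1]≡[n+1]C[k+1] k m ⟩
    suc k C suc m      ∎
    where open ≡-Reasoning

count-masks : ∀ k m → countIf (λ x → does (onesRow x ℕ.≟ m)) (allVecs bits k) ≡ k C m
count-masks k m = trans (countIf-∑ _ (allVecs bits k)) (∑-masks k m)

select : Vec Bool k → Vec A k → List A
select []          []      = []
select (false ∷ x) (a ∷ v) = select x v
select (true ∷ x)  (a ∷ v) = a ∷ select x v

-- Places ys, in order, at the positions where x is true and d elsewhere; a short ys is padded
-- with d and a long one truncated, so this is a right inverse of select x only when the lengths fit.
expand : Vec Bool k → List A → A → Vec A k
expand []          ys       d = []
expand (false ∷ x) ys       d = d ∷ expand x ys d
expand (true ∷ x)  []       d = d ∷ expand x [] d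
expand (true ∷ x)  (y ∷ ys) d = y ∷ expand x ys d

length-select : (x : Vec Bool k) (v : Vec A k) → length (select x v) ≡ onesRow x
length-select []          []      = refl
length-select (false ∷ x) (a ∷ v) = length-select x v
length-select (true ∷ x)  (a ∷ v) = cong suc (length-select x v)

select-expand : (x : Vec Bool k) (ys : List A) (d : A) → length ys ≡ onesRow x →
                select x (expand x ys d) ≡ ys
select-expand []          []       d eq = refl
select-expand (false ∷ x) ys       d eq = select-expand x ys d eq
select-expand (true ∷ x)  (y ∷ ys) d eq = cong (y ∷_) (select-expand x ys d (ℕP.suc-injective eq))

expand-select-expand : (x : Vec Bool k) (ys : List A) (d : A) →
                       expand x (select x (expand x ys d)) d ≡ expand x ys d
expand-select-expand []          ys       d = refl
expand-select-expand (false ∷ x) ys       d = cong (d ∷_) (expand-select-expand x ys d)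
expand-select-expand (true ∷ x)  []       d = cong (d ∷_) (expand-select-expand x [] d)
expand-select-expand (true ∷ x)  (y ∷ ys) d = cong (y ∷_) (expand-select-expand x ys d)

expand-select : (p : A → Bool) (d : A) → (∀ a → p a ≡ false → a ≡ d) →
                (v : Vec A k) → expand (Vec.map p v) (select (Vec.map p v) v) d ≡ v
expand-select p d p≡false⇒d []      = refl
expand-select p d p≡false⇒d (a ∷ v) with p a in pa
... | true  = cong (a ∷_) (expand-select p d p≡false⇒d v)
... | false = cong₂ _∷_ (sym (p≡false⇒d a pa)) (expand-select p d p≡false⇒d v)

map-select : (g : A → B) (x : Vec Bool k) (v : Vec A k) →
             List.map g (select x v) ≡ select x (Vec.map g v)
map-select g []          []      = refl
map-select g (false ∷ x) (a ∷ v) = map-select g x v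
map-select g (true ∷ x)  (a ∷ v) = cong (g a ∷_) (map-select g x v)

map-expand : (g : A → B) (x : Vec Bool k) (ys : List A) (d : A) →
             Vec.map g (expand x ys d) ≡ expand x (List.map g ys) (g d)
map-expand g []          ys       d = refl
map-expand g (false ∷ x) ys       d = cong (g d ∷_) (map-expand g x ys d)
map-expand g (true ∷ x)  []       d = cong (g d ∷_) (map-expand g x [] d)
map-expand g (true ∷ x)  (y ∷ ys) d = cong (g y ∷_) (map-expand g x ys d)

expand-replicate : (x : Vec Bool k) (d : A) → expand x (List.replicate m d) d ≡ replicate k d
expand-replicate []          d = refl
expand-replicate (false ∷ x) d = cong (d ∷_) (expand-replicate x d)
expand-replicate {m = zero}  (true ∷ x) d = cong (d ∷_) (expand-replicate x d)
expand-replicate {m = suc m} (true ∷ x) d = cong (d ∷_) (expand-replicate x d)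

foldr-expand : (f : A → B → B) (e : B) (x : Vec Bool k) (ys : List A) (d : A) →
               (∀ b → f d b ≡ b) → length ys ≡ onesRow x →
               List.foldr f e (toList (expand x ys d)) ≡ List.foldr f e ys
foldr-expand f e []          []       d fd eq = refl
foldr-expand f e (false ∷ x) ys       d fd eq = trans (fd _) (foldr-expand f e x ys d fd eq)
foldr-expand f e (true ∷ x)  (y ∷ ys) d fd eq = cong (f y) (foldr-expand f e x ys d fd (ℕP.suc-injective eq))

onesRow-expand : (x : Vec Bool k) (ys : List Bool) → length ys ≡ onesRow x →
                 onesRow (expand x ys false) ≡ length (filter (λ b → b BoolP.≟ true) ys)
onesRow-expand []          []           eq = refl
onesRow-expand (false ∷ x) ys           eq = onesRow-expand x ys eq
onesRow-expand (true ∷ x)  (true ∷ ys)  eq = cong suc (onesRow-expand x ys (ℕP.suc-injective eq))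
onesRow-expand (true ∷ x)  (false ∷ ys) eq = onesRow-expand x ys (ℕP.suc-injective eq)

expand-and : (x : Vec Bool k) (ys : List Bool) → length ys ≡ onesRow x → and ys ≡ true →
             expand x ys false ≡ x
expand-and []          []          eq all = refl
expand-and (false ∷ x) ys          eq all = cong (false ∷_) (expand-and x ys eq all)
expand-and (true ∷ x)  (true ∷ ys) eq all = cong (true ∷_) (expand-and x ys (ℕP.suc-injective eq) all)

onesRow-replicate : ∀ k → onesRow (replicate k false) ≡ 0
onesRow-replicate zero    = refl
onesRow-replicate (suc k) = onesRow-replicate k

nonzeroRow-replicate : ∀ k → nonzeroRow (replicate k false) ≡ false
nonzeroRow-replicate zero    = refl
nonzeroRow-replicate (suc k) = nonzeroRow-replicate k

nonzeroRow≡false⇒replicate : (r : Vec Bool k) → nonzeroRow r ≡ false → r ≡ replicate k false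
nonzeroRow≡false⇒replicate []          eq = refl
nonzeroRow≡false⇒replicate (false ∷ r) eq = cong (false ∷_) (nonzeroRow≡false⇒replicate r eq)

map-zipWith : {C D : Set} (g : C → D) (f : A → B → C) (u : Vec A n) (v : Vec B n) →
              Vec.map g (zipWith f u v) ≡ zipWith (λ a b → g (f a b)) u v
map-zipWith g f []      []      = refl
map-zipWith g f (a ∷ u) (b ∷ v) = cong (g (f a b) ∷_) (map-zipWith g f u v)

transpose-∷ : (r : Vec A n) (R : Vec (Vec A n) m) → transpose (r ∷ R) ≡ zipWith _∷_ r (transpose R)
transpose-∷ r R = sym (VecP.zipWith-is-⊛ _∷_ r (transpose R))

transpose-replicate-∷ : (d : A) (R : Vec (Vec A n) m) →
                        transpose (replicate n d ∷ R) ≡ Vec.map (d ∷_) (transpose R)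
transpose-replicate-∷ d R = trans (transpose-∷ _ R) (VecP.zipWith-replicate₁ _∷_ d (transpose R))

transpose-zipWith-∷ : (r : Vec A n) (R : Vec (Vec A m) n) → transpose (zipWith _∷_ r R) ≡ r ∷ transpose R
transpose-zipWith-∷ []      []      = refl
transpose-zipWith-∷ (a ∷ r) (s ∷ R) = begin
  transpose ((a ∷ s) ∷ zipWith _∷_ r R)              ≡⟨ transpose-∷ (a ∷ s) (zipWith _∷_ r R) ⟩
  zipWith _∷_ (a ∷ s) (transpose (zipWith _∷_ r R))  ≡⟨ cong (zipWith _∷_ (a ∷ s)) (transpose-zipWith-∷ r R) ⟩
  (a ∷ r) ∷ zipWith _∷_ s (transpose R)              ≡⟨ cong ((a ∷ r) ∷_) (transpose-∷ s R) ⟨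
  (a ∷ r) ∷ transpose (s ∷ R)                        ∎
  where open ≡-Reasoning

transpose-involutive : (R : Vec (Vec A n) m) → transpose (transpose R) ≡ R
transpose-involutive []      = VecP.transpose-replicate []
transpose-involutive (r ∷ R) = begin
  transpose (transpose (r ∷ R))            ≡⟨ cong transpose (transpose-∷ r R) ⟩
  transpose (zipWith _∷_ r (transpose R))  ≡⟨ transpose-zipWith-∷ r (transpose R) ⟩
  r ∷ transpose (transpose R)              ≡⟨ cong (r ∷_) (transpose-involutive R) ⟩
  r ∷ R                                    ∎
  where open ≡-Reasoning

transpose-expand : (x : Vec Bool k) (V : Vec (Vec A n) m) (d : A) →
  transpose (expand x (toList V) (replicate n d)) ≡ Vec.map (λ c → expand x (toList c) d) (transpose V)
transpose-expand []          V       d = sym (VecP.map-const (transpose V) [])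
transpose-expand (false ∷ x) V       d = begin
  transpose (replicate _ d ∷ expand x (toList V) (replicate _ d))
    ≡⟨ transpose-replicate-∷ d (expand x (toList V) (replicate _ d)) ⟩
  Vec.map (d ∷_) (transpose (expand x (toList V) (replicate _ d)))
    ≡⟨ cong (Vec.map (d ∷_)) (transpose-expand x V d) ⟩
  Vec.map (d ∷_) (Vec.map (λ c → expand x (toList c) d) (transpose V))
    ≡⟨ VecP.map-∘ (d ∷_) _ (transpose V) ⟨
  Vec.map (λ c → d ∷ expand x (toList c) d) (transpose V) ∎
  where open ≡-Reasoning
transpose-expand (true ∷ x)  []      d = begin
  transpose (replicate _ d ∷ expand x [] (replicate _ d))
    ≡⟨ transpose-replicate-∷ d (expand x [] (replicate _ d)) ⟩
  Vec.map (d ∷_) (transpose (expand x [] (replicate _ d)))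
    ≡⟨ cong (Vec.map (d ∷_)) (transpose-expand x [] d) ⟩
  Vec.map (d ∷_) (Vec.map (λ c → expand x (toList c) d) (transpose []))
    ≡⟨ VecP.map-∘ (d ∷_) _ (transpose []) ⟨
  Vec.map (λ c → d ∷ expand x (toList c) d) (transpose [])
    ≡⟨ VecP.map-cong (λ { [] → refl }) (transpose []) ⟩
  Vec.map (λ c → expand (true ∷ x) (toList c) d) (transpose []) ∎
  where open ≡-Reasoning
transpose-expand (true ∷ x)  (v ∷ V) d = begin
  transpose (v ∷ expand x (toList V) (replicate _ d))
    ≡⟨ transpose-∷ v (expand x (toList V) (replicate _ d)) ⟩
  zipWith _∷_ v (transpose (expand x (toList V) (replicate _ d)))
    ≡⟨ cong (zipWith _∷_ v) (transpose-expand x V d) ⟩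
  zipWith _∷_ v (Vec.map (λ c → expand x (toList c) d) (transpose V))
    ≡⟨ VecP.zipWith-map₂ _∷_ _ v (transpose V) ⟩
  zipWith (λ a c → a ∷ expand x (toList c) d) v (transpose V)
    ≡⟨ map-zipWith _ _∷_ v (transpose V) ⟨
  Vec.map (λ c → expand (true ∷ x) (toList c) d) (zipWith _∷_ v (transpose V))
    ≡⟨ cong (Vec.map _) (transpose-∷ v V) ⟨
  Vec.map (λ c → expand (true ∷ x) (toList c) d) (transpose (v ∷ V)) ∎
  where open ≡-Reasoning

transpose-map-expand : (x : Vec Bool k) (V : Vec (Vec A m) n) (d : A) →
  transpose (Vec.map (λ r → expand x (toList r) d) V) ≡ expand x (toList (transpose V)) (replicate n d)
transpose-map-expand x V d = begin
  transpose (Vec.map (λ r → expand x (toList r) d) V)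
    ≡⟨ cong (transpose ∘ Vec.map _) (transpose-involutive V) ⟨
  transpose (Vec.map (λ r → expand x (toList r) d) (transpose (transpose V)))
    ≡⟨ cong transpose (transpose-expand x (transpose V) d) ⟨
  transpose (transpose (expand x (toList (transpose V)) (replicate _ d)))
    ≡⟨ transpose-involutive _ ⟩
  expand x (toList (transpose V)) (replicate _ d) ∎
  where open ≡-Reasoning

-- Reductions of symmetric matrices

rowmask : Vec (Vec Bool n) k → Vec Bool k
rowmask A = Vec.map nonzeroRow A

filter-select : (p : A → Bool) (v : Vec A k) →
                filter (λ a → p a BoolP.≟ true) (toList v) ≡ select (Vec.map p v) v
filter-select p []      = refl
filter-select p (a ∷ v) with p a
... | true  = cong (a ∷_) (filter-select p v)
... | false = filter-select p v

zip-select : (x : Vec Bool k) (v : Vec A k) →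
             List.map proj₂ (filter (λ q → proj₁ q BoolP.≟ true) (zip (toList x) (toList v))) ≡ select x v
zip-select []          []      = refl
zip-select (false ∷ x) (a ∷ v) = zip-select x v
zip-select (true ∷ x)  (a ∷ v) = cong (a ∷_) (zip-select x v)

deleteZeroRowsCols-select : (A : Matrix k) →
  deleteZeroRowsCols A ≡ List.map (select (rowmask (transpose A))) (select (rowmask A) A)
deleteZeroRowsCols-select A = begin
  deleteZeroRowsCols A
    ≡⟨ ListP.map-cong (λ r → trans (cong (λ c → List.map proj₂ (filter _ (zip c (toList r))))
                                         (sym (VecP.toList-map nonzeroRow (transpose A))))
                                   (zip-select (rowmask (transpose A)) r)) _ ⟩
  List.map (select (rowmask (transpose A))) (filter (λ r → nonzeroRow r BoolP.≟ true) (toList A))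
    ≡⟨ cong (List.map _) (filter-select nonzeroRow A) ⟩
  List.map (select (rowmask (transpose A))) (select (rowmask A) A) ∎
  where open ≡-Reasoning

length-deleteZeroRowsCols : (A : Matrix k) → length (deleteZeroRowsCols A) ≡ onesRow (rowmask A)
length-deleteZeroRowsCols A = begin
  length (deleteZeroRowsCols A)               ≡⟨ cong length (deleteZeroRowsCols-select A) ⟩
  length (List.map _ (select (rowmask A) A))  ≡⟨ ListP.length-map _ (select (rowmask A) A) ⟩
  length (select (rowmask A) A)               ≡⟨ length-select (rowmask A) A ⟩
  onesRow (rowmask A)                         ∎
  where open ≡-Reasoning

expandRow : Vec Bool k → Vec Bool m → Vec Bool k
expandRow x r = expand x (toList r) false

-- Inserts zero rows and columns into M at the positions where x is false.
expandMatrix : Vec Bool k → Matrix m → Matrix k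
expandMatrix {k} x M = expand x (toList (Vec.map (expandRow x) M)) (replicate k false)

transpose-expandMatrix : (x : Vec Bool k) (M : Matrix m) →
                         transpose (expandMatrix x M) ≡ expandMatrix x (transpose M)
transpose-expandMatrix {k} {m} x M = begin
  transpose (expandMatrix x M)
    ≡⟨ transpose-expand x (Vec.map (expandRow x) M) false ⟩
  Vec.map (expandRow x) (transpose (Vec.map (expandRow x) M))
    ≡⟨ cong (Vec.map (expandRow x)) (transpose-map-expand x M false) ⟩
  Vec.map (expandRow x) (expand x (toList (transpose M)) (replicate m false))
    ≡⟨ map-expand (expandRow x) x (toList (transpose M)) (replicate m false) ⟩
  expand x (List.map (expandRow x) (toList (transpose M))) (expandRow x (replicate m false))
    ≡⟨ cong₂ (expand x) (sym (VecP.toList-map (expandRow x) (transpose M))) expandRow-zero ⟩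
  expandMatrix x (transpose M) ∎
  where
  open ≡-Reasoning
  expandRow-zero : expandRow x (replicate m false) ≡ replicate k false
  expandRow-zero = trans (cong (λ l → expand x l false) (VecP.toList-replicate m false)) (expand-replicate x false)

expandMatrix-symmetric : (x : Vec Bool k) {M : Matrix m} → M ≡ transpose M →
                         expandMatrix x M ≡ transpose (expandMatrix x M)
expandMatrix-symmetric x {M} M-sym = sym (trans (transpose-expandMatrix x M) (cong (expandMatrix x) (sym M-sym)))

map-toList-map : {C : Set} (f : B → C) (g : A → B) (v : Vec A k) →
                 List.map f (toList (Vec.map g v)) ≡ List.map (f ∘ g) (toList v)
map-toList-map f g v = trans (cong (List.map f) (VecP.toList-map g v)) (sym (ListP.map-∘ (toList v)))

module _ (x : Vec Bool k) (M : Matrix m) (x-ones : onesRow x ≡ m) where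

  private
    rows : List (Vec Bool k)
    rows = toList (Vec.map (expandRow x) M)

    fits : (v : Vec B m) → length (toList v) ≡ onesRow x
    fits v = trans (VecP.length-toList v) (sym x-ones)

    rows-fit : length rows ≡ onesRow x
    rows-fit = fits (Vec.map (expandRow x) M)

  rowmask-expandMatrix : and (List.map nonzeroRow (toList M)) ≡ true → rowmask (expandMatrix x M) ≡ x
  rowmask-expandMatrix M-nonzero = begin
    rowmask (expand x rows (replicate k false))
      ≡⟨ map-expand nonzeroRow x rows (replicate k false) ⟩
    expand x (List.map nonzeroRow rows) (nonzeroRow (replicate k false))
      ≡⟨ cong₂ (expand x) rows-nonzero (nonzeroRow-replicate k) ⟩
    expand x (List.map nonzeroRow (toList M)) false
      ≡⟨ expand-and x _ (trans (ListP.length-map nonzeroRow (toList M)) (fits M)) M-nonzero ⟩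
    x ∎
    where
    open ≡-Reasoning
    rows-nonzero : List.map nonzeroRow rows ≡ List.map nonzeroRow (toList M)
    rows-nonzero = trans (map-toList-map nonzeroRow (expandRow x) M)
      (ListP.map-cong (λ r → foldr-expand _∨_ false x (toList r) false (λ _ → refl) (fits r)) (toList M))

  ones-expandMatrix : ones (expandMatrix x M) ≡ ones M
  ones-expandMatrix = begin
    sum (List.map onesRow (toList (expand x rows (replicate k false))))
      ≡⟨ cong sum (VecP.toList-map onesRow (expand x rows (replicate k false))) ⟨
    sum (toList (Vec.map onesRow (expand x rows (replicate k false))))
      ≡⟨ cong (sum ∘ toList) (map-expand onesRow x rows (replicate k false)) ⟩
    sum (toList (expand x (List.map onesRow rows) (onesRow (replicate k false))))
      ≡⟨ cong (λ d → sum (toList (expand x (List.map onesRow rows) d))) (onesRow-replicate k) ⟩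
    sum (toList (expand x (List.map onesRow rows) 0))
      ≡⟨ foldr-expand _+_ 0 x _ 0 (λ _ → refl) (trans (ListP.length-map onesRow rows) rows-fit) ⟩
    sum (List.map onesRow rows)
      ≡⟨ cong sum (trans (map-toList-map onesRow (expandRow x) M)
                         (ListP.map-cong (λ r → onesRow-expand x (toList r) (fits r)) (toList M))) ⟩
    ones M ∎
    where open ≡-Reasoning

  deleteZeroRowsCols-expandMatrix : M ≡ transpose M → and (List.map nonzeroRow (toList M)) ≡ true →
                                    deleteZeroRowsCols (expandMatrix x M) ≡ asLists M
  deleteZeroRowsCols-expandMatrix M-sym M-nonzero = begin
    deleteZeroRowsCols E
      ≡⟨ deleteZeroRowsCols-select E ⟩
    List.map (select (rowmask (transpose E))) (select (rowmask E) E)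
      ≡⟨ cong₂ (λ c r → List.map (select c) (select r E)) (trans (cong rowmask E-sym) E-mask) E-mask ⟩
    List.map (select x) (select x (expand x rows (replicate k false)))
      ≡⟨ cong (List.map (select x)) (select-expand x rows (replicate k false) rows-fit) ⟩
    List.map (select x) rows
      ≡⟨ map-toList-map (select x) (expandRow x) M ⟩
    List.map (select x ∘ expandRow x) (toList M)
      ≡⟨ ListP.map-cong (λ r → select-expand x (toList r) false (fits r)) (toList M) ⟩
    asLists M ∎
    where
    open ≡-Reasoning
    E = expandMatrix x M
    E-mask : rowmask E ≡ x
    E-mask = rowmask-expandMatrix M-nonzero
    E-sym : transpose E ≡ E
    E-sym = sym (expandMatrix-symmetric x M-sym)

expand-select-rows : (A : Vec (Vec Bool n) k) → expand (rowmask A) (select (rowmask A) A) (replicate n false) ≡ A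
expand-select-rows A = expand-select nonzeroRow (replicate _ false) nonzeroRow≡false⇒replicate A

expand-select-columns : (A : Matrix k) → A ≡ transpose A →
                        Vec.map (λ r → expand (rowmask A) (select (rowmask A) r) false) A ≡ A
expand-select-columns {k} A A-sym = begin
  Vec.map g A                                      ≡⟨ cong (Vec.map g) A-columns ⟩
  Vec.map g (Vec.map (expandRow x) (transpose W))  ≡⟨ VecP.map-∘ g (expandRow x) (transpose W) ⟨
  Vec.map (g ∘ expandRow x) (transpose W)
    ≡⟨ VecP.map-cong (λ c → expand-select-expand x (toList c) false) (transpose W) ⟩
  Vec.map (expandRow x) (transpose W)              ≡⟨ A-columns ⟨
  A                                                ∎
  where
  open ≡-Reasoning
  x = rowmask A
  g : Vec Bool k → Vec Bool k
  g r = expand x (select x r) false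
  W = fromList (select x A)

  -- By symmetry the zero rows are also zero columns, so every row of A lies in the image of expandRow x.
  A-columns : A ≡ Vec.map (expandRow x) (transpose W)
  A-columns = begin
    A                                                        ≡⟨ A-sym ⟩
    transpose A                                              ≡⟨ cong transpose (expand-select-rows A) ⟨
    transpose (expand x (select x A) (replicate k false))
      ≡⟨ cong (λ rs → transpose (expand x rs (replicate k false))) (VecP.toList∘fromList (select x A)) ⟨
    transpose (expand x (toList W) (replicate k false))      ≡⟨ transpose-expand x W false ⟩
    Vec.map (expandRow x) (transpose W)                      ∎

expandMatrix-rowmask : (A : Matrix k) (M : Matrix m) → A ≡ transpose A → deleteZeroRowsCols A ≡ asLists M →
                       expandMatrix (rowmask A) M ≡ A
expandMatrix-rowmask {k} A M A-sym A-reduces = begin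
  expand x (toList (Vec.map (expandRow x) M)) zeros
    ≡⟨ cong (λ rs → expand x rs zeros) (trans (VecP.toList-map (expandRow x) M) (ListP.map-∘ (toList M))) ⟩
  expand x (List.map e (asLists M)) zeros
    ≡⟨ cong (λ rs → expand x (List.map e rs) zeros) reduced ⟩
  expand x (List.map e (List.map (select x) (select x A))) zeros
    ≡⟨ cong (λ rs → expand x rs zeros) (ListP.map-∘ (select x A)) ⟨
  expand x (List.map (e ∘ select x) (select x A)) zeros
    ≡⟨ cong (λ rs → expand x rs zeros) (map-select (e ∘ select x) x A) ⟩
  expand x (select x (Vec.map (e ∘ select x) A)) zeros
    ≡⟨ cong (λ B → expand x (select x B) zeros) (expand-select-columns A A-sym) ⟩
  expand x (select x A) zeros
    ≡⟨ expand-select-rows A ⟩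
  A ∎
  where
  open ≡-Reasoning
  x = rowmask A
  zeros = replicate k false

  e : List Bool → Vec Bool k
  e l = expand x l false

  reduced : asLists M ≡ List.map (select x) (select x A)
  reduced = trans (sym A-reduces)
    (trans (deleteZeroRowsCols-select A) (cong (λ B → List.map (select (rowmask B)) (select x A)) (sym A-sym)))

≟-Matrix : DecidableEquality (Matrix k)
≟-Matrix = VecP.≡-dec (VecP.≡-dec BoolP._≟_)

isSymmetric⇒≡transpose : (A : Matrix k) → isSymmetric A ≡ true → A ≡ transpose A
isSymmetric⇒≡transpose A A-sym = invert (subst (Reflects _) A-sym (Dec.proof (≟-Matrix A (transpose A))))

reducesTo : Matrix m → Matrix k → Bool
reducesTo M A = eqLL (deleteZeroRowsCols A) (asLists M)

count-reductions : (n : ℕ) (M : Matrix m) → M ≡ transpose M → ones M ≡ n →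
  and (List.map nonzeroRow (toList M)) ≡ true →
  ∀ k → countIf (λ A → symWithOnes n A ∧ reducesTo M A) (allMatrices k) ≡ k C m
count-reductions {m} n M M-sym M-ones M-nonzero k = begin
  countIf (λ A → symWithOnes n A ∧ reducesTo M A) (allMatrices k)
    ≡⟨ countIf-cong (allMatrices k) (λ A → cong (λ b → (isSymmetric A ∧ b) ∧ _) (isYes≗does (ones A ℕ.≟ n))) ⟩
  countIf (does ∘ P?) (allMatrices k)
    ≡⟨ countIf-bijection Q? P? ≟-Matrix {allVecs bits k} {allMatrices k}
         (enumerates-allVecs enumerates-bits k) (enumerates-allMatrices k)
         (λ x → expandMatrix x M) rowmask expand⁺ rowmask⁺
         (λ x-ones → rowmask-expandMatrix _ M x-ones M-nonzero)
         (λ { ((A-sym , _) , A-reduces) → expandMatrix-rowmask _ M A-sym A-reduces }) ⟨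
  countIf (does ∘ Q?) (allVecs bits k)
    ≡⟨ count-masks k m ⟩
  k C m ∎
  where
  open ≡-Reasoning
  P : Matrix k → Set
  P A = (A ≡ transpose A × ones A ≡ n) × deleteZeroRowsCols A ≡ asLists M

  P? : Decidable P
  P? A = (≟-Matrix A (transpose A) ×-dec ones A ℕ.≟ n)
         ×-dec ListP.≡-dec (ListP.≡-dec BoolP._≟_) (deleteZeroRowsCols A) (asLists M)

  Q : Vec Bool k → Set
  Q x = onesRow x ≡ m

  Q? : Decidable Q
  Q? x = onesRow x ℕ.≟ m

  expand⁺ : ∀ {x} → Q x → P (expandMatrix x M)
  expand⁺ {x} x-ones = (expandMatrix-symmetric x M-sym , trans (ones-expandMatrix x M x-ones) M-ones)
                     , deleteZeroRowsCols-expandMatrix x M x-ones M-sym M-nonzero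

  rowmask⁺ : ∀ {A} → P A → Q (rowmask A)
  rowmask⁺ {A} (_ , A-reduces) = begin
    onesRow (rowmask A)            ≡⟨ length-deleteZeroRowsCols A ⟨
    length (deleteZeroRowsCols A)  ≡⟨ cong length A-reduces ⟩
    length (asLists M)             ≡⟨ ListP.length-map toList (toList M) ⟩
    length (toList M)              ≡⟨ VecP.length-toList M ⟩
    m                              ∎

-- The negative binomial series

binomialPrefix : ℕ → ℕ → ℕ
binomialPrefix zero    K = 0
binomialPrefix (suc j) K = binomialPrefix j K + K C j

binomialPrefix-zero : ∀ m → binomialPrefix (suc m) 0 ≡ 1
binomialPrefix-zero zero    = refl
binomialPrefix-zero (suc m) = trans (ℕP.+-identityʳ _) (binomialPrefix-zero m)

binomialPrefix-pascal : ∀ j K → binomialPrefix (suc j) (suc K) ≡ binomialPrefix (suc j) K + binomialPrefix j K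
binomialPrefix-pascal zero    K = refl
binomialPrefix-pascal (suc j) K = begin
  binomialPrefix (suc j) (suc K) + suc K C suc j
    ≡⟨ cong₂ _+_ (binomialPrefix-pascal j K) (sym (nCk+nC[k+1]≡[n+1]C[k+1] K j)) ⟩
  (binomialPrefix (suc j) K + binomialPrefix j K) + (K C j + K C suc j)
    ≡⟨ rearrange (binomialPrefix (suc j) K) (binomialPrefix j K) (K C j) (K C suc j) ⟩
  (binomialPrefix (suc j) K + K C suc j) + (binomialPrefix j K + K C j) ∎
  where
  open ≡-Reasoning
  rearrange : ∀ a b c d → (a + b) + (c + d) ≡ (a + d) + (b + c)
  rearrange = solve-∀

binomialPrefix-double : ∀ m K → K C m + binomialPrefix (suc m) (suc K) ≡ 2 * binomialPrefix (suc m) K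
binomialPrefix-double m K =
  trans (cong (K C m +_) (binomialPrefix-pascal m K)) (rearrange (binomialPrefix m K) (K C m))
  where
  rearrange : ∀ b c → c + ((b + c) + b) ≡ 2 * (b + c)
  rearrange = solve-∀

n<2^n : ∀ n → n < 2 ^ n
n<2^n zero    = s≤s z≤n
n<2^n (suc n) = ℕP.+-mono-≤-< (ℕP.m^n>0 2 n) (ℕP.<-≤-trans (n<2^n n) (ℕP.m≤m+n (2 ^ n) 0))

-- From N₀ on each increment binomialPrefix j K of binomialPrefix (suc j) is below 2^K / 2q, so
-- 2q · binomialPrefix (suc j) K stays below c + 2^K for a constant c, and c < 2^K for K ≥ N₀ + c.
binomialPrefix-eventually-< : ∀ j q → ∃ λ N → ∀ K → N ≤ K → q * binomialPrefix j K < 2 ^ K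
binomialPrefix-eventually-< zero    q = 0 , λ K _ → subst (_< 2 ^ K) (sym (ℕP.*-zeroʳ q)) (ℕP.m^n>0 2 K)
binomialPrefix-eventually-< (suc j) q = N₀ + c , bound
  where
  N₀ = proj₁ (binomialPrefix-eventually-< j (2 * q))
  below : ∀ K → N₀ ≤ K → 2 * q * binomialPrefix j K < 2 ^ K
  below = proj₂ (binomialPrefix-eventually-< j (2 * q))
  c = 2 * q * binomialPrefix (suc j) N₀

  growth : ∀ t → 2 * q * binomialPrefix (suc j) (t + N₀) ≤ c + 2 ^ (t + N₀)
  growth zero    = ℕP.m≤m+n c (2 ^ N₀)
  growth (suc t) = begin
    2 * q * binomialPrefix (suc j) (suc (t + N₀))
      ≡⟨ cong (2 * q *_) (binomialPrefix-pascal j (t + N₀)) ⟩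
    2 * q * (binomialPrefix (suc j) (t + N₀) + binomialPrefix j (t + N₀))
      ≡⟨ ℕP.*-distribˡ-+ (2 * q) _ _ ⟩
    2 * q * binomialPrefix (suc j) (t + N₀) + 2 * q * binomialPrefix j (t + N₀)
      ≤⟨ ℕP.+-mono-≤ (growth t) (ℕP.<⇒≤ (below (t + N₀) (ℕP.m≤n+m N₀ t))) ⟩
    c + 2 ^ (t + N₀) + 2 ^ (t + N₀)
      ≡⟨ rearrange c (2 ^ (t + N₀)) ⟩
    c + 2 ^ (suc t + N₀) ∎
    where
    open ℕP.≤-Reasoning
    rearrange : ∀ a b → a + b + b ≡ a + 2 * b
    rearrange = solve-∀

  bound : ∀ K → N₀ + c ≤ K → q * binomialPrefix (suc j) K < 2 ^ K
  bound K N₀+c≤K = ℕP.*-cancelˡ-< 2 _ _ (begin-strict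
    2 * (q * binomialPrefix (suc j) K)       ≡⟨ ℕP.*-assoc 2 q _ ⟨
    2 * q * binomialPrefix (suc j) K         ≡⟨ cong (λ L → 2 * q * binomialPrefix (suc j) L) t+N₀≡K ⟨
    2 * q * binomialPrefix (suc j) (t + N₀)  ≤⟨ growth t ⟩
    c + 2 ^ (t + N₀)                         <⟨ ℕP.+-monoˡ-< (2 ^ (t + N₀)) c<2^K ⟩
    2 ^ (t + N₀) + 2 ^ (t + N₀)              ≡⟨ cong (λ L → 2 ^ L + 2 ^ L) t+N₀≡K ⟩
    2 ^ K + 2 ^ K                            ≡⟨ cong (2 ^ K +_) (ℕP.+-identityʳ (2 ^ K)) ⟨
    2 * 2 ^ K                                ∎)
    where
    open ℕP.≤-Reasoning
    t = K ∸ N₀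
    t+N₀≡K : t + N₀ ≡ K
    t+N₀≡K = ℕP.m∸n+n≡m (ℕP.≤-trans (ℕP.m≤m+n N₀ c) N₀+c≤K)
    c<2^K : c < 2 ^ (t + N₀)
    c<2^K = begin-strict
      c             ≡⟨ ℕP.m+n∸m≡n N₀ c ⟨
      N₀ + c ∸ N₀   ≤⟨ ℕP.∸-monoˡ-≤ N₀ N₀+c≤K ⟩
      t             <⟨ n<2^n t ⟩
      2 ^ t         ≤⟨ ℕP.^-monoʳ-≤ 2 (ℕP.m≤m+n t N₀) ⟩
      2 ^ (t + N₀)  ∎

toℚᵘ-frac : ∀ a b → toℚᵘ (frac a (suc b)) ℚᵘ.≃ mkℚᵘ (ℤ.+ a) b
toℚᵘ-frac a b = ℚP.toℚᵘ-fromℚᵘ (mkℚᵘ (ℤ.+ a) b)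

frac-cross : ∀ a b c d → a * suc d ≡ c * suc b → frac a (suc b) ≡ frac c (suc d)
frac-cross a b c d eq = ℚP.toℚᵘ-injective (begin
  toℚᵘ (frac a (suc b))  ≈⟨ toℚᵘ-frac a b ⟩
  mkℚᵘ (ℤ.+ a) b         ≈⟨ *≡* (trans (sym (ℤP.pos-* a (suc d))) (trans (cong ℤ.+_ eq) (ℤP.pos-* c (suc b)))) ⟩
  mkℚᵘ (ℤ.+ c) d         ≈⟨ toℚᵘ-frac c d ⟨
  toℚᵘ (frac c (suc d))  ∎)
  where open ℚᵘP.≃-Reasoning

frac-zero : ∀ b → frac 0 b ≡ 0ℚ
frac-zero zero    = refl
frac-zero (suc b) = ℚP.toℚᵘ-injective (ℚᵘP.≃-trans (toℚᵘ-frac 0 b) (*≡* refl))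

frac-nonNeg : ∀ a b → 0ℚ ℚ.≤ frac a b
frac-nonNeg a zero    = ℚP.≤-refl
frac-nonNeg a (suc b) = ℚP.nonNegative⁻¹ _ {{ℚP.normalize-nonNeg a (suc b)}}

frac-cancelˡ : ∀ k a b → frac (suc k * a) (suc k * b) ≡ frac a b
frac-cancelˡ k a zero    = cong (frac _) (ℕP.*-zeroʳ (suc k))
frac-cancelˡ k a (suc b) = frac-cross (suc k * a) (b + k * suc b) a b (rearrange (suc k) a (suc b))
  where
  rearrange : ∀ k a b → k * a * b ≡ a * (k * b)
  rearrange = solve-∀

frac-+ : ∀ a c b → frac a b ℚ.+ frac c b ≡ frac (a + c) b
frac-+ a c zero    = refl
frac-+ a c (suc b) = trans (ℚP.toℚᵘ-injective (begin
  toℚᵘ (frac a D ℚ.+ frac c D)               ≈⟨ ℚP.toℚᵘ-homo-+ (frac a D) (frac c D) ⟩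
  toℚᵘ (frac a D) ℚᵘ.+ toℚᵘ (frac c D)       ≈⟨ ℚᵘP.+-cong (toℚᵘ-frac a b) (toℚᵘ-frac c b) ⟩
  mkℚᵘ (ℤ.+ a) b ℚᵘ.+ mkℚᵘ (ℤ.+ c) b         ≡⟨ cong (λ z → mkℚᵘ z _) numerator ⟨
  mkℚᵘ (ℤ.+ (a * D + c * D)) (b + b * D)     ≈⟨ toℚᵘ-frac _ _ ⟨
  toℚᵘ (frac (a * D + c * D) (D * D))        ∎))
  (frac-cross (a * D + c * D) (b + b * D) (a + c) b (rearrange a c D))
  where
  open ℚᵘP.≃-Reasoning
  D = suc b
  numerator : ℤ.+ (a * D + c * D) ≡ ℤ.+ a ℤ.* ℤ.+ D ℤ.+ ℤ.+ c ℤ.* ℤ.+ D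
  numerator = trans (ℤP.pos-+ (a * D) (c * D)) (cong₂ ℤ._+_ (ℤP.pos-* a D) (ℤP.pos-* c D))
  rearrange : ∀ a c D → (a * D + c * D) * D ≡ (a + c) * (D * D)
  rearrange = solve-∀

frac-* : ∀ a b c d → frac a b ℚ.* frac c d ≡ frac (a * c) (b * d)
frac-* a zero    c d       = ℚP.*-zeroˡ (frac c d)
frac-* a (suc b) c zero    = trans (ℚP.*-zeroʳ (frac a (suc b))) (cong (frac (a * c)) (sym (ℕP.*-zeroʳ (suc b))))
frac-* a (suc b) c (suc d) = ℚP.toℚᵘ-injective (begin
  toℚᵘ (frac a (suc b) ℚ.* frac c (suc d))          ≈⟨ ℚP.toℚᵘ-homo-* (frac a (suc b)) (frac c (suc d)) ⟩
  toℚᵘ (frac a (suc b)) ℚᵘ.* toℚᵘ (frac c (suc d))  ≈⟨ ℚᵘP.*-cong (toℚᵘ-frac a b) (toℚᵘ-frac c d) ⟩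
  mkℚᵘ (ℤ.+ a) b ℚᵘ.* mkℚᵘ (ℤ.+ c) d                ≡⟨ cong (λ z → mkℚᵘ z _) (ℤP.pos-* a c) ⟨
  mkℚᵘ (ℤ.+ (a * c)) (d + b * suc d)                ≈⟨ toℚᵘ-frac _ _ ⟨
  toℚᵘ (frac (a * c) (suc b * suc d))               ∎)
  where open ℚᵘP.≃-Reasoning

frac-*-cancel : ∀ s c D → c ≤ s → frac s D ℚ.* frac c s ≡ frac c D
frac-*-cancel zero    .zero D z≤n = trans (ℚP.*-zeroʳ (frac 0 D)) (sym (frac-zero D))
frac-*-cancel (suc s) c     D _   = begin
  frac (suc s) D ℚ.* frac c (suc s)  ≡⟨ frac-* (suc s) D c (suc s) ⟩
  frac (suc s * c) (D * suc s)       ≡⟨ cong (frac _) (ℕP.*-comm D (suc s)) ⟩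
  frac (suc s * c) (suc s * D)       ≡⟨ frac-cancelˡ s c D ⟩
  frac c D                           ∎
  where open ≡-Reasoning

frac-<-frac : ∀ a b c d → 0 < b → 0 < d → a * d < c * b → frac a b ℚ.< frac c d
frac-<-frac a (suc b) c (suc d) _ _ lt = ℚP.toℚᵘ-cancel-<
  (ℚᵘP.<-respˡ-≃ (ℚᵘP.≃-sym (toℚᵘ-frac a b)) (ℚᵘP.<-respʳ-≃ (ℚᵘP.≃-sym (toℚᵘ-frac c d))
    (*<* (subst₂ ℤ._<_ (ℤP.pos-* a (suc d)) (ℤP.pos-* c (suc b)) (ℤ.+<+ lt)))))

partialSum-cong : {f g : ℕ → ℚ} → (∀ k → f k ≡ g k) → ∀ K → partialSum f K ≡ partialSum g K
partialSum-cong f≗g zero    = refl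
partialSum-cong f≗g (suc K) = cong₂ ℚ._+_ (partialSum-cong f≗g K) (f≗g K)

HasSum-cong : {f g : ℕ → ℚ} {L : ℚ} → (∀ k → f k ≡ g k) → HasSum g L → HasSum f L
HasSum-cong {L = L} f≗g g→L ε ε>0 =
  let N , close = g→L ε ε>0 in
  N , λ K N≤K → subst (λ s → ∣ s ℚ.- L ∣ ℚ.< ε) (sym (partialSum-cong f≗g K)) (close K N≤K)

HasSum-remainder : (f r : ℕ → ℚ) (L : ℚ) → (∀ K → partialSum f K ℚ.+ r K ≡ L) → (∀ K → 0ℚ ℚ.≤ r K) →
  (∀ ε → 0ℚ ℚ.< ε → ∃ λ N → ∀ K → N ≤ K → r K ℚ.< ε) → HasSum f L
HasSum-remainder f r L split r≥0 r→0 ε ε>0 =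
  let N , small = r→0 ε ε>0 in
  N , λ K N≤K → subst (ℚ._< ε) (sym (distance K)) (small K N≤K)
  where
  open ≡-Reasoning
  distance : ∀ K → ∣ partialSum f K ℚ.- L ∣ ≡ r K
  distance K = begin
    ∣ partialSum f K ℚ.- L ∣                         ≡⟨ cong ∣_∣ (⁻¹-anti-homo‿- L (partialSum f K)) ⟨
    ∣ ℚ.- (L ℚ.- partialSum f K) ∣                   ≡⟨ ℚP.∣-p∣≡∣p∣ (L ℚ.- partialSum f K) ⟩
    ∣ L ℚ.- partialSum f K ∣                         ≡⟨ cong (λ L → ∣ L ℚ.- partialSum f K ∣) (split K) ⟨
    ∣ partialSum f K ℚ.+ r K ℚ.- partialSum f K ∣    ≡⟨ cong ∣_∣ (xyx⁻¹≈y (partialSum f K) (r K)) ⟩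
    ∣ r K ∣                                          ≡⟨ ℚP.0≤p⇒∣p∣≡p (r≥0 K) ⟩
    r K                                              ∎

binomialRemainder : ℕ → ℕ → ℕ → ℚ
binomialRemainder m S K = frac (binomialPrefix (suc m) K) (2 ^ K * S)

partialSum-binomial : ∀ m S K →
  partialSum (λ k → frac (k C m) (2 ^ suc k * S)) K ℚ.+ binomialRemainder m S K ≡ frac 1 S
partialSum-binomial m S zero    = trans (ℚP.+-identityˡ _) (cong₂ frac (binomialPrefix-zero m) (ℕP.+-identityʳ S))
partialSum-binomial m S (suc K) = begin
  partialSum f K ℚ.+ f K ℚ.+ binomialRemainder m S (suc K)    ≡⟨ ℚP.+-assoc (partialSum f K) (f K) _ ⟩
  partialSum f K ℚ.+ (f K ℚ.+ binomialRemainder m S (suc K))  ≡⟨ cong (λ t → partialSum f K ℚ.+ t) step ⟩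
  partialSum f K ℚ.+ binomialRemainder m S K                  ≡⟨ partialSum-binomial m S K ⟩
  frac 1 S                                                    ∎
  where
  open ≡-Reasoning
  f : ℕ → ℚ
  f k = frac (k C m) (2 ^ suc k * S)
  step : f K ℚ.+ binomialRemainder m S (suc K) ≡ binomialRemainder m S K
  step = begin
    f K ℚ.+ binomialRemainder m S (suc K)
      ≡⟨ frac-+ (K C m) _ (2 ^ suc K * S) ⟩
    frac (K C m + binomialPrefix (suc m) (suc K)) (2 ^ suc K * S)
      ≡⟨ cong₂ frac (binomialPrefix-double m K) (ℕP.*-assoc 2 (2 ^ K) S) ⟩
    frac (2 * binomialPrefix (suc m) K) (2 * (2 ^ K * S))
      ≡⟨ frac-cancelˡ 1 (binomialPrefix (suc m) K) (2 ^ K * S) ⟩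
    binomialRemainder m S K ∎

binomialRemainder-eventually-< : ∀ m S ε → 0ℚ ℚ.< ε → ∃ λ N → ∀ K → N ≤ K → binomialRemainder m S K ℚ.< ε
binomialRemainder-eventually-< m zero    ε ε>0 = 0 , λ K _ →
  subst (λ D → frac (binomialPrefix (suc m) K) D ℚ.< ε) (sym (ℕP.*-zeroʳ (2 ^ K))) ε>0
binomialRemainder-eventually-< m (suc S) ε@(mkℚ (ℤ.+ suc p) d _) _ =
  let N , below = binomialPrefix-eventually-< (suc m) (suc d) in
  N , λ K N≤K → subst (binomialRemainder m (suc S) K ℚ.<_) (ℚP.↥p/↧p≡p ε)
    (frac-<-frac (binomialPrefix (suc m) K) (2 ^ K * suc S) (suc p) (suc d) (D>0 K) (s≤s z≤n) (cross K (below K N≤K)))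
  where
  open ℕP.≤-Reasoning
  D>0 : ∀ K → 0 < 2 ^ K * suc S
  D>0 K = ℕP.*-mono-≤ (ℕP.m^n>0 2 K) (s≤s z≤n)
  cross : ∀ K → suc d * binomialPrefix (suc m) K < 2 ^ K →
          binomialPrefix (suc m) K * suc d < suc p * (2 ^ K * suc S)
  cross K below = begin-strict
    binomialPrefix (suc m) K * suc d  ≡⟨ ℕP.*-comm _ (suc d) ⟩
    suc d * binomialPrefix (suc m) K  <⟨ below ⟩
    2 ^ K                             ≤⟨ ℕP.m≤m*n (2 ^ K) (suc S) ⟩
    2 ^ K * suc S                     ≤⟨ ℕP.m≤n*m _ (suc p) ⟩
    suc p * (2 ^ K * suc S)           ∎
binomialRemainder-eventually-< m (suc S) (mkℚ (ℤ.+ zero) d _) (ℚ.*<* (ℤ.+<+ ()))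
binomialRemainder-eventually-< m (suc S) (mkℚ -[1+ p ] d _) (ℚ.*<* ())

-- ∑_k C(k,m) 2^-(k+1) = 1, divided by S; for S = 0 both sides are 0 since frac _ 0 = 0.
HasSum-binomial : ∀ m S → HasSum (λ k → frac (k C m) (2 ^ suc k * S)) (frac 1 S)
HasSum-binomial m S = HasSum-remainder _ (binomialRemainder m S) (frac 1 S) (partialSum-binomial m S)
  (λ K → frac-nonNeg (binomialPrefix (suc m) K) (2 ^ K * S)) (binomialRemainder-eventually-< m S)

theorem4 : (n : ℕ) → 1 ≤ n → (m : ℕ) (M : Matrix m) →
    isSymmetric M ≡ true → ones M ≡ n → noZeroRowCol M ≡ true →
    outputProb n M (frac 1 (S11 n))
theorem4 n _ m M M-sym M-ones M-noZero = HasSum-cong term (HasSum-binomial m (S11 n))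
  where
  open ≡-Reasoning
  term : ∀ k → ψ n k ℚ.* condProb n k M ≡ frac (k C m) (2 ^ suc k * S11 n)
  term k = begin
    ψ n k ℚ.* condProb n k M
      ≡⟨ frac-*-cancel (s n k) _ (2 ^ suc k * S11 n) (countIf-∧-≤ (symWithOnes n) (reducesTo M) (allMatrices k)) ⟩
    frac (countIf (λ A → symWithOnes n A ∧ reducesTo M A) (allMatrices k)) (2 ^ suc k * S11 n)
      ≡⟨ cong (λ c → frac c (2 ^ suc k * S11 n))
              (count-reductions n M (isSymmetric⇒≡transpose M M-sym) M-ones (BoolP.∧-conicalˡ _ _ M-noZero) k) ⟩
    frac (k C m) (2 ^ suc k * S11 n) ∎
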